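{- Every universal-flow formula is preserved under surjective Chu transforms. That is, if $\varphi(\bm{v}^\mathsf{p},\bm{v}^\mathsf{s})$ is a universal-flow formula and $(f,g)$ is a Chu transform from a Chu space $\langle X,r,A\rangle$ to a Chu space $\langle Y,s,B\rangle$ with $f$ surjective, then for all tuples $\bm{x}$ in $X$ and $\bm{b}$ in $B$, \[ \langle X,r,A\rangle\models\varphi[\bm{x},g(\bm{b})]\implies\langle Y,s,B\rangle\models\varphi[f(\bm{x}),\bm{b}]. \]
   Context: A Chu space is a triple $\langle X,r,A\rangle$ with $r\subseteq X\times A$. A Chu transform from $\langle X,r,A\rangle$ to $\langle Y,s,B\rangle$ is a pair of functions $f\colon X\to Y$, $g\colon B\to A$ such that for all $x\in X$, $b\in B$: $\langle x,g(b)\rangle\in r\iff\langle f(x),b\rangle\in s$; it is surjective if $f$ is surjective. A Chu space is viewed as a two-sorted structure (disjoint sorts: points $X$, states $A$) for the two-sorted infinitary language $\mathcal{L}^\mathrm{II}_{\infty,\infty}$ with point variables $v^\mathsf{p}$, state variables $v^\mathsf{s}$, a binary relation symbol $R$ interpreted as $r$, equality within each sort, negation, infinitary conjunctions/disjunctions and quantification over possibly infinite tuples of variables of either sort; $f(\bm{x})$, $g(\bm{b})$ denote pointwise application. The universal-flow formulas are defined recursively: $(v^\mathsf{p}_0=v^\mathsf{p}_1)$, $\lnot(v^\mathsf{s}_0=v^\mathsf{s}_1)$, $R(v^\mathsf{p},v^\mathsf{s})$, $\lnot R(v^\mathsf{p},v^\mathsf{s})$ are universal-flow formulas; infinitary conjunctions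 and disjunctions of universal-flow formulas are universal-flow formulas; if $\varphi$ is universal-flow then $\exists\bm{v}^\mathsf{p}\varphi$, $\forall\bm{v}^\mathsf{p}\varphi$ and $\forall\bm{v}^\mathsf{s}\varphi$ are universal-flow formulas. -}

module Defs where

open import Data.Product using (Σ; ∃; _×_; _,_)
open import Data.Sum using (_⊎_; inj₁; inj₂; [_,_])
open import Relation.Binary.PropositionalEquality using (_≡_)
open import Relation.Nullary using (¬_)

record Chu : Set₁ where
  field
    Pt  : Set
    St  : Set
    rel : Pt → St → Set
open Chu public

record ChuTransform (C D : Chu) : Set where
  field
    fwd : Pt C → Pt D
    bwd : St D → St C
    adj : ∀ (x : Pt C) (b : St D) →
          (rel C x (bwd b) → rel D (fwd x) b) × (rel D (fwd x) b → rel C x (bwd b))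
open ChuTransform public

Surjective : {X Y : Set} → (X → Y) → Set
Surjective {X} {Y} f = ∀ (y : Y) → ∃ λ (x : X) → f x ≡ y

SurjectiveChuTransform : Chu → Chu → Set
SurjectiveChuTransform C D = Σ (ChuTransform C D) λ t → Surjective (fwd t)

-- P : set of free point variables, S : set of free state variables.
-- Quantification over a (possibly infinite) tuple of variables indexed by
-- I binds fresh variables, represented by extending the context with I.
data Formula (P S : Set) : Set₁ where
  eqᵖ  : P → P → Formula P S
  eqˢ  : S → S → Formula P S
  R    : P → S → Formula P S
  ¬'   : Formula P S → Formula P S
  ⋀    : (I : Set) → (I → Formula P S) → Formula P S
  ⋁    : (I : Set) → (I → Formula P S) → Formula P S
  ∃ᵖ   : (I : Set) → Formula (P ⊎ I) S → Formula P S
  ∀ᵖ   : (I : Set) → Formula (P ⊎ I) S → Formula P S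
  ∃ˢ   : (I : Set) → Formula P (S ⊎ I) → Formula P S
  ∀ˢ   : (I : Set) → Formula P (S ⊎ I) → Formula P S

_⊨_[_,_] : {P S : Set} (C : Chu) → Formula P S → (P → Pt C) → (S → St C) → Set
C ⊨ eqᵖ u v [ x , a ] = x u ≡ x v
C ⊨ eqˢ u v [ x , a ] = a u ≡ a v
C ⊨ R u v   [ x , a ] = rel C (x u) (a v)
C ⊨ ¬' φ    [ x , a ] = ¬ (C ⊨ φ [ x , a ])
C ⊨ ⋀ I φ   [ x , a ] = ∀ (i : I) → C ⊨ φ i [ x , a ]
C ⊨ ⋁ I φ   [ x , a ] = ∃ λ (i : I) → C ⊨ φ i [ x , a ]
C ⊨ ∃ᵖ I φ  [ x , a ] = ∃ λ (y : I → Pt C) → C ⊨ φ [ [ x , y ] , a ]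
C ⊨ ∀ᵖ I φ  [ x , a ] = ∀ (y : I → Pt C) → C ⊨ φ [ [ x , y ] , a ]
C ⊨ ∃ˢ I φ  [ x , a ] = ∃ λ (b : I → St C) → C ⊨ φ [ x , [ a , b ] ]
C ⊨ ∀ˢ I φ  [ x , a ] = ∀ (b : I → St C) → C ⊨ φ [ x , [ a , b ] ]

data UniversalFlow : {P S : Set} → Formula P S → Set₁ where
  uf-eqᵖ   : ∀ {P S} (u v : P) → UniversalFlow {P} {S} (eqᵖ u v)
  uf-neqˢ  : ∀ {P S} (u v : S) → UniversalFlow {P} {S} (¬' (eqˢ u v))
  uf-R     : ∀ {P S} (u : P) (v : S) → UniversalFlow (R u v)
  uf-¬R    : ∀ {P S} (u : P) (v : S) → UniversalFlow (¬' (R u v))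
  uf-⋀     : ∀ {P S} (I : Set) (φ : I → Formula P S) →
             (∀ i → UniversalFlow (φ i)) → UniversalFlow (⋀ I φ)
  uf-⋁     : ∀ {P S} (I : Set) (φ : I → Formula P S) →
             (∀ i → UniversalFlow (φ i)) → UniversalFlow (⋁ I φ)
  uf-∃ᵖ    : ∀ {P S} (I : Set) (φ : Formula (P ⊎ I) S) →
             UniversalFlow φ → UniversalFlow (∃ᵖ I φ)
  uf-∀ᵖ    : ∀ {P S} (I : Set) (φ : Formula (P ⊎ I) S) →
             UniversalFlow φ → UniversalFlow (∀ᵖ I φ)
  uf-∀ˢ    : ∀ {P S} (I : Set) (φ : Formula P (S ⊎ I)) →
             UniversalFlow φ → UniversalFlow (∀ˢ I φ)

{-# OPTIONS --safe #-}
module Submission where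

-- Induction on universal-flow formulas, for assignments that agree with f ∘ x
-- and g ∘ b only pointwise (extending them under a quantifier gives [ x , y ],
-- which is not definitionally a composite).  Atoms and negated atoms transfer
-- along the adjointness of (f , g), negated state equalities because g is a
-- function.  ∃ᵖ is witnessed by the f-image of a witness, ∀ˢ is instantiated
-- at the g-image of the given states, and surjectivity of f is needed exactly
-- for ∀ᵖ, to lift the given points of D to points of C.

open import Defs
open import Data.Product using (∃; proj₁; proj₂; _,_)
open import Data.Sum using ([_,_])
open import Function using (_∘_)
open import Relation.Binary.PropositionalEquality
  using (_≡_; _≗_; refl; sym; cong; module ≡-Reasoning)

≗-∘-cong : {A B C : Set} (h : B → C) {x : A → B} {x′ : A → C} →
           x′ ≗ h ∘ x → ∀ {u v} → x u ≡ x v → x′ u ≡ x′ v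
≗-∘-cong h {x} {x′} x′≗hx {u} {v} xu≡xv = begin
  x′ u    ≡⟨ x′≗hx u ⟩
  h (x u) ≡⟨ cong h xu≡xv ⟩
  h (x v) ≡⟨ x′≗hx v ⟨
  x′ v    ∎
  where open ≡-Reasoning

surjective-lifts-tuples : {I X Y : Set} {f : X → Y} → Surjective f →
                          (y′ : I → Y) → ∃ λ y → y′ ≗ f ∘ y
surjective-lifts-tuples surj y′ = proj₁ ∘ surj ∘ y′ , sym ∘ proj₂ ∘ surj ∘ y′

module _ {C D : Chu} (T : ChuTransform C D) where

  private
    f : Pt C → Pt D
    f = fwd T

    g : St D → St C
    g = bwd T

  rel-preserved : ∀ {x x′ a b} → x′ ≡ f x → a ≡ g b → rel C x a → rel D x′ b
  rel-preserved {x} {b = b} refl refl = proj₁ (adj T x b)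

  rel-reflected : ∀ {x x′ a b} → x′ ≡ f x → a ≡ g b → rel D x′ b → rel C x a
  rel-reflected {x} {b = b} refl refl = proj₂ (adj T x b)

  module _ (f-surjective : Surjective f) where

    universalFlow-preserved :
      {P S : Set} (φ : Formula P S) → UniversalFlow φ →
      (x : P → Pt C) (x′ : P → Pt D) (a : S → St C) (b : S → St D) →
      x′ ≗ f ∘ x → a ≗ g ∘ b → C ⊨ φ [ x , a ] → D ⊨ φ [ x′ , b ]
    universalFlow-preserved _ (uf-eqᵖ u v) x x′ a b x′≗fx a≗gb =
      ≗-∘-cong f x′≗fx
    universalFlow-preserved _ (uf-neqˢ u v) x x′ a b x′≗fx a≗gb au≢av =
      au≢av ∘ ≗-∘-cong g a≗gb
    universalFlow-preserved _ (uf-R u v) x x′ a b x′≗fx a≗gb =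
      rel-preserved (x′≗fx u) (a≗gb v)
    universalFlow-preserved _ (uf-¬R u v) x x′ a b x′≗fx a≗gb ¬r =
      ¬r ∘ rel-reflected (x′≗fx u) (a≗gb v)
    universalFlow-preserved _ (uf-⋀ I φ uf) x x′ a b x′≗fx a≗gb ⊨φ i =
      universalFlow-preserved (φ i) (uf i) x x′ a b x′≗fx a≗gb (⊨φ i)
    universalFlow-preserved _ (uf-⋁ I φ uf) x x′ a b x′≗fx a≗gb (i , ⊨φi) =
      i , universalFlow-preserved (φ i) (uf i) x x′ a b x′≗fx a≗gb ⊨φi
    universalFlow-preserved _ (uf-∃ᵖ I φ uf) x x′ a b x′≗fx a≗gb (y , ⊨φ) =
      f ∘ y ,
      universalFlow-preserved φ uf [ x , y ] [ x′ , f ∘ y ] a b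
        [ x′≗fx , (λ _ → refl) ] a≗gb ⊨φ
    universalFlow-preserved _ (uf-∀ᵖ I φ uf) x x′ a b x′≗fx a≗gb ⊨φ y′ =
      let y , y′≗fy = surjective-lifts-tuples f-surjective y′ in
      universalFlow-preserved φ uf [ x , y ] [ x′ , y′ ] a b
        [ x′≗fx , y′≗fy ] a≗gb (⊨φ y)
    universalFlow-preserved _ (uf-∀ˢ I φ uf) x x′ a b x′≗fx a≗gb ⊨φ c =
      universalFlow-preserved φ uf x x′ [ a , g ∘ c ] [ b , c ]
        x′≗fx [ a≗gb , (λ _ → refl) ] (⊨φ (g ∘ c))

proposition3p8 : {P S : Set} (φ : Formula P S) → UniversalFlow φ →
    (C D : Chu) (t : SurjectiveChuTransform C D) →
    (x : P → Pt C) (b : S → St D) →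
    C ⊨ φ [ x , bwd (proj₁ t) ∘ b ] → D ⊨ φ [ fwd (proj₁ t) ∘ x , b ]
proposition3p8 φ uf C D (T , f-surjective) x b =
  universalFlow-preserved T f-surjective φ uf x _ _ b (λ _ → refl) (λ _ → refl)
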